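{- Let $d>0$, $k\ge1$ and $i\ge0$. If $X$ is an $\omega^{2d+1}$-large finite set with $\min X>\max\{k,i,2\}$, then $X$ is $(\omega^d,k,i)$-persistent.
   Context: Strings are finite binary sequences; $\preceq$ is initial segment, $\tau$ extends $\sigma$ if $\sigma\preceq\tau$, incompatible means neither is an initial segment of the other; $2^i$ is the set of strings of length $i$; a tree is a set of strings closed under initial segments; a leaf is a node with no proper extension in the tree. For finite $X=\{x_0<\dots<x_n\}$, a finite tree $T$ is $X$-quasistrong if $T\cap 2^{x_i}\ne\emptyset$ for all $i\le n$ and for each $i<n$ every $\sigma\in T\cap 2^{x_i}$ has exactly two incompatible extensions in $T\cap 2^{x_{i+1}}$. Largeness: a stack is a sequence of nonempty finite sets $X_0<X_1<\dots$ (where $X<Y$ means $\max X<\min Y$). A nonempty finite $X$ is $\omega$-large if $|X|>\min X$; $\omega^d\cdot n$-large if it is the union of a stack of $n$ many $\omega^d$-large sets; $\omega^{d+1}$-large if $X=\{\min X\}\cup X_1$ with $\min X_1>\min X$ and $X_1$ $\omega^d\cdot\min X$-large. Persistence: for $\alpha=\omega^d\cdot n$ ($d,n\ge1$), $X$ is $(\alpha,k,0)$-persistent if it is $\alpha$-large; for $i\ge1$, $X$ is $(\alpha,k,i)$-persistent if $X$ contains an $(\alpha,k,i-1)$-persistent subset $Y$ such that for every $X$-quasistrong tree $T$ and every $C:T\cap 2^{\max X}\to k$ there exist $c<k$ and a $Y$-quasistrong finite tree $S\subseteq T$ every leaf of which has an extension in $C^{ -1}(c)$. -}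

module Defs where

open import Data.Nat using (ℕ; zero; suc; _<_; _⊔_; _∸_)
open import Data.Bool using (Bool)
open import Data.Fin using (Fin)
open import Data.List using (List; []; _∷_; _++_; length; foldr)
open import Data.List.Membership.Propositional using (_∈_)
open import Data.List.Relation.Unary.All using (All)
open import Data.List.Relation.Unary.Linked using (Linked)
open import Data.List.Relation.Binary.Subset.Propositional using (_⊆_)
open import Data.Product using (Σ; _×_; ∃; ∃-syntax)
open import Data.Sum using (_⊎_)
open import Relation.Binary.PropositionalEquality using (_≡_; _≢_)
open import Relation.Nullary using (¬_)

-- Finite sets of naturals are represented as strictly increasing lists.

Increasing : List ℕ → Set
Increasing = Linked _<_

minL : List ℕ → ℕ
minL []      = 0
minL (x ∷ _) = x

maxL : List ℕ → ℕ
maxL = foldr _⊔_ 0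

_<ˢ_ : List ℕ → List ℕ → Set
X <ˢ Y = All (λ x → All (x <_) Y) X

-- Largeness.  PowLarge e X   : X is ω^(e+1)-large
--             MulLarge e n X : X is ω^(e+1)·n-large
--               (X is the union of a stack X₀ < X₁ < … of n ω^(e+1)-large sets)

mutual
  data PowLarge : ℕ → List ℕ → Set where
    base : ∀ {x xs} → x < length (x ∷ xs) → PowLarge zero (x ∷ xs)
    step : ∀ {e x y ys} → x < y → MulLarge e x (y ∷ ys) → PowLarge (suc e) (x ∷ y ∷ ys)

  data MulLarge (e : ℕ) : ℕ → List ℕ → Set where
    none : MulLarge e zero []
    more : ∀ {n X Y} → PowLarge e X → X <ˢ Y → MulLarge e n Y → MulLarge e (suc n) (X ++ Y)

-- paper's notation, for d ≥ 1
ω^_-large : ℕ → List ℕ → Set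
ω^ d -large = PowLarge (d ∸ 1)

ω^_·_-large : ℕ → ℕ → List ℕ → Set
ω^ d · n -large = MulLarge (d ∸ 1) n

Str : Set
Str = List Bool

_⪯_ : Str → Str → Set
σ ⪯ τ = ∃[ ρ ] (σ ++ ρ ≡ τ)

Incompatible : Str → Str → Set
Incompatible σ τ = ¬ (σ ⪯ τ) × ¬ (τ ⪯ σ)

IsTree : List Str → Set
IsTree T = ∀ {σ τ} → σ ∈ T → τ ⪯ σ → τ ∈ T

IsLeaf : List Str → Str → Set
IsLeaf T σ = σ ∈ T × (∀ {τ} → τ ∈ T → σ ⪯ τ → τ ≡ σ)

data Consec : ℕ → ℕ → List ℕ → Set where
  here  : ∀ {x y xs} → Consec x y (x ∷ y ∷ xs)
  there : ∀ {x y z xs} → Consec x y xs → Consec x y (z ∷ xs)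

Quasistrong : List ℕ → List Str → Set
Quasistrong X T =
  IsTree T
  × (∀ {x} → x ∈ X → ∃[ σ ] (σ ∈ T × length σ ≡ x))
  × (∀ {x y} → Consec x y X → ∀ {σ} → σ ∈ T → length σ ≡ x →
       ∃[ τ₁ ] ∃[ τ₂ ]
         ( Incompatible τ₁ τ₂
         × (τ₁ ∈ T × length τ₁ ≡ y × σ ⪯ τ₁)
         × (τ₂ ∈ T × length τ₂ ≡ y × σ ⪯ τ₂)
         × (∀ {τ} → τ ∈ T → length τ ≡ y → σ ⪯ τ → τ ≡ τ₁ ⊎ τ ≡ τ₂)))

-- Persistence, for α = ω^d·n (d, n ≥ 1).
-- Colourings C : T ∩ 2^(max X) → k are represented by total functions Str → Fin k;
-- only their values on T ∩ 2^(max X) are used.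

Persistent : (d n k i : ℕ) → List ℕ → Set
Persistent d n k zero    X = ω^ d · n -large X
Persistent d n k (suc i) X =
  ∃[ Y ] ( Increasing Y × Y ⊆ X × Persistent d n k i Y
         × (∀ (T : List Str) → Quasistrong X T → (C : Str → Fin k) →
              ∃[ c ] ∃[ S ] ( Quasistrong Y S × S ⊆ T
                × (∀ {σ} → IsLeaf S σ →
                     ∃[ τ ] (τ ∈ T × length τ ≡ maxL X × σ ⪯ τ × C τ ≡ c)))))

{-# OPTIONS --safe #-}
module Submission where

-- Persistence is witnessed by a chain X ⊇ Y₁ ⊇ ⋯ ⊇ Yᵢ in which each Yⱼ₊₁ is k-sparse in Yⱼ
-- (every element kept is followed by at least k dropped ones) and Yᵢ is ω^d-large. Sparseness
-- is what makes a quasistrong tree on Yⱼ homogeneous: between consecutive levels of Yⱼ₊₁ every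
-- node has at least 2^(k+1) > k descendants, so by the pigeonhole principle, working from the top
-- level down, two of them carry homogeneous subtrees of the same colour. Such a chain can be cut
-- out of one ((k+1)^i − 1)-sparse ω^d-large subset of X, and one exists because an
-- ω^(2d+1)-large set keeps an ω^d-large subset after spending two levels of largeness per level
-- kept, with gaps of size 2^2^(min X + 1) ≥ (k+1)^i supplied by the fast growth of its first blocks.

open import Defs
open import Data.Empty using (⊥-elim)
open import Data.Fin as Fin using (Fin; fromℕ<)
open import Data.Fin.Properties using (pigeonhole)
open import Data.List using (List; []; _∷_; _++_; length; map; concatMap; inits; lookup)
open import Data.List.Properties using (++-assoc; ++-identityʳ; length-++; ∷-injectiveˡ; ∷-injectiveʳ)
open import Data.List.Membership.Propositional using (_∈_)
open import Data.List.Membership.Propositional.Properties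
  using (∈-++⁺ˡ; ∈-++⁺ʳ; ∈-++⁻; ∈-map⁺; ∈-map⁻; ∈-concat⁺′; ∈-concat⁻′; ∈-lookup)
open import Data.List.Relation.Binary.Subset.Propositional using (_⊆_)
open import Data.List.Relation.Unary.All as All using (All; []; _∷_)
import Data.List.Relation.Unary.All.Properties as All
open import Data.List.Relation.Unary.AllPairs using (AllPairs; []; _∷_)
import Data.List.Relation.Unary.AllPairs.Properties as AllPairs
open import Data.List.Relation.Unary.Any using (here; there)
open import Data.List.Relation.Unary.Linked.Properties using (Linked⇒AllPairs; AllPairs⇒Linked)
open import Data.Nat using (ℕ; zero; suc; _<_; _≤_; _⊔_; _*_; _+_; _∸_; _^_; z≤n; s≤s)
open import Data.Nat.Properties
open import Data.Nat.Tactic.RingSolver using (solve-∀)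
open import Data.Product using (_×_; ∃; ∃-syntax; _,_; proj₁; proj₂)
open import Data.Sum using (_⊎_; inj₁; inj₂; swap)
open import Function using (_∘_)
open import Relation.Binary.PropositionalEquality

Ascending : List ℕ → Set
Ascending = AllPairs _<_

module _ {A : Set} {R : A → A → Set} where

  AllPairs-++⁻ˡ : ∀ xs {ys} → AllPairs R (xs ++ ys) → AllPairs R xs
  AllPairs-++⁻ˡ []       _        = []
  AllPairs-++⁻ˡ (x ∷ xs) (r ∷ rs) = All.++⁻ˡ xs r ∷ AllPairs-++⁻ˡ xs rs

  AllPairs-++⁻ʳ : ∀ xs {ys} → AllPairs R (xs ++ ys) → AllPairs R ys
  AllPairs-++⁻ʳ []       rs       = rs
  AllPairs-++⁻ʳ (x ∷ xs) (_ ∷ rs) = AllPairs-++⁻ʳ xs rs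

splitAt-≤ : ∀ {A : Set} t (L : List A) → t ≤ length L →
            ∃[ L₁ ] ∃[ L₂ ] (L ≡ L₁ ++ L₂ × length L₁ ≡ t)
splitAt-≤ zero    L       _         = [] , L , refl , refl
splitAt-≤ (suc t) (x ∷ L) (s≤s t≤L) with L₁ , L₂ , refl , refl ← splitAt-≤ t L t≤L =
  x ∷ L₁ , L₂ , refl , refl

length-++-≤ʳ : ∀ {A : Set} (L₁ : List A) {L₂ n} → length L₁ + n ≤ length (L₁ ++ L₂) → n ≤ length L₂
length-++-≤ʳ L₁ le = +-cancelˡ-≤ (length L₁) _ _ (subst (length L₁ + _ ≤_) (length-++ L₁) le)

All-≥-++ : ∀ (A : List ℕ) {Z} a → Ascending (A ++ Z) → All (a ≤_) (A ++ Z) → All (a + length A ≤_) Z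
All-≥-++ []      {Z} a _          a≤ = subst (λ q → All (q ≤_) Z) (sym (+-identityʳ a)) a≤
All-≥-++ (x ∷ A) {Z} a (x< ∷ asc) (a≤x ∷ a≤) =
  subst (λ q → All (q ≤_) Z) (sym (+-suc a (length A)))
    (All-≥-++ A (suc a) asc (All.map (≤-trans (s≤s a≤x)) x<))

n<2^n : ∀ n → n < 2 ^ n
n<2^n zero    = s≤s z≤n
n<2^n (suc n) = subst (_≤ 2 ^ suc n) (+-comm (suc n) 1)
  (+-mono-≤ (n<2^n n) (subst (1 ≤_) (sym (+-identityʳ (2 ^ n))) (m^n>0 2 n)))

-- Largeness

PowLarge-nonempty : ∀ {e X} → PowLarge e X → 1 ≤ length X
PowLarge-nonempty (base _)   = s≤s z≤n
PowLarge-nonempty (step _ _) = s≤s z≤n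

MulLarge-length : ∀ {e n X} → MulLarge e n X → n ≤ length X
MulLarge-length none                  = z≤n
MulLarge-length (more {n} {X} p _ m) =
  subst (suc n ≤_) (sym (length-++ X)) (+-mono-≤ (PowLarge-nonempty p) (MulLarge-length m))

All-minL : ∀ {e X} {Q : ℕ → Set} → All Q X → PowLarge e X → Q (minL X)
All-minL (q ∷ _) (base _)   = q
All-minL (q ∷ _) (step _ _) = q

mutual
  PowLarge-pred : ∀ {e X} → PowLarge (suc e) X → PowLarge e X
  PowLarge-pred {zero}  (step _ m)   = base (s≤s (MulLarge-length m))
  PowLarge-pred {suc e} (step x<y m) = step x<y (MulLarge-pred m)

  MulLarge-pred : ∀ {e n X} → MulLarge (suc e) n X → MulLarge e n X
  MulLarge-pred none         = none
  MulLarge-pred (more p o m) = more (PowLarge-pred p) o (MulLarge-pred m)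

PowLarge-anti : ∀ {e e′ X} → e′ ≤ e → PowLarge e X → PowLarge e′ X
PowLarge-anti {e} {e′} e′≤e p =
  go (e ∸ e′) (subst (λ z → PowLarge z _) (sym (m∸n+n≡m e′≤e)) p)
  where
  go : ∀ n {X} → PowLarge (n + e′) X → PowLarge e′ X
  go zero    p = p
  go (suc n) p = go n (PowLarge-pred p)

PowLarge⇒minL<length : ∀ {e X} → PowLarge e X → minL X < length X
PowLarge⇒minL<length p with base lt ← PowLarge-anti z≤n p = lt

PowLarge⇒MulLarge₁ : ∀ {e X} → PowLarge e X → MulLarge e 1 X
PowLarge⇒MulLarge₁ {e} {X} p =
  subst (MulLarge e 1) (++-identityʳ X) (more p (All.tabulate (λ _ → [])) none)

MulLarge-take : ∀ {e n L} → MulLarge e n L → ∀ j → j ≤ n →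
                ∃[ L₁ ] ∃[ L₂ ] (L ≡ L₁ ++ L₂ × MulLarge e j L₁)
MulLarge-take m zero _ = [] , _ , refl , none
MulLarge-take (more {X = X} p X<Y m) (suc j) (s≤s j≤n)
  with L₁ , L₂ , refl , m₁ ← MulLarge-take m j j≤n =
  X ++ L₁ , L₂ , sym (++-assoc X L₁ L₂) , more p (All.map (All.++⁻ˡ L₁) X<Y) m₁

MulLarge-firstThree : ∀ {e n L} → MulLarge e n L → 3 ≤ n →
  ∃[ D₁ ] ∃[ D₂ ] ∃[ D₃ ] ∃[ R ]
    (L ≡ D₁ ++ D₂ ++ D₃ ++ R × PowLarge e D₁ × PowLarge e D₂ × PowLarge e D₃)
MulLarge-firstThree (more p₁ _ (more p₂ _ (more p₃ _ _))) (s≤s (s≤s (s≤s _))) =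
  _ , _ , _ , _ , refl , p₁ , p₂ , p₃

-- Sparse sublists

data Sparse (G : ℕ) : List ℕ → List ℕ → Set where
  []   : ∀ {W} → Sparse G W []
  skip : ∀ {w W Z} → Sparse G W Z → Sparse G (w ∷ W) Z
  keep : ∀ {w P W Z} → G ≤ length P → Sparse G W Z → Sparse G (w ∷ P ++ W) (w ∷ Z)

module _ {G : ℕ} where

  keep-++ : ∀ {w} P {W₁ W₂ Z} → G ≤ length P → Sparse G (W₁ ++ W₂) Z →
            Sparse G (w ∷ (P ++ W₁) ++ W₂) (w ∷ Z)
  keep-++ {w} P {W₁} {W₂} {Z} G≤P s =
    subst (λ L → Sparse G (w ∷ L) (w ∷ Z)) (sym (++-assoc P W₁ W₂)) (keep {P = P} G≤P s)

  skip-++ : ∀ U {W Z} → Sparse G W Z → Sparse G (U ++ W) Z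
  skip-++ []      s = s
  skip-++ (u ∷ U) s = skip (skip-++ U s)

  Sparse-++ : ∀ {W₁ Z₁ W₂ Z₂} → Sparse G W₁ Z₁ → Sparse G W₂ Z₂ → Sparse G (W₁ ++ W₂) (Z₁ ++ Z₂)
  Sparse-++ {W₁} []              s₂ = skip-++ W₁ s₂
  Sparse-++ (skip s)             s₂ = skip (Sparse-++ s s₂)
  Sparse-++ (keep {P = P} G≤P s) s₂ = keep-++ P G≤P (Sparse-++ s s₂)

  Sparse-++ʳ : ∀ {W Z} W′ → Sparse G W Z → Sparse G (W ++ W′) Z
  Sparse-++ʳ {Z = Z} W′ s = subst (Sparse G _) (++-identityʳ Z) (Sparse-++ s ([] {W = W′}))

  Sparse-All : ∀ {W Z} {Q : ℕ → Set} → Sparse G W Z → All Q W → All Q Z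
  Sparse-All []                 _        = []
  Sparse-All (skip s)           (_ ∷ qs) = Sparse-All s qs
  Sparse-All (keep {P = P} _ s) (q ∷ qs) = q ∷ Sparse-All s (All.++⁻ʳ P qs)

  Sparse-⊆ : ∀ {W Z} → Sparse G W Z → Z ⊆ W
  Sparse-⊆ (skip s)           z∈Z         = there (Sparse-⊆ s z∈Z)
  Sparse-⊆ (keep _ s)         (here refl) = here refl
  Sparse-⊆ (keep {P = P} _ s) (there z∈Z) = there (∈-++⁺ʳ P (Sparse-⊆ s z∈Z))

  Sparse-AllPairs : ∀ {W Z} {R : ℕ → ℕ → Set} → Sparse G W Z → AllPairs R W → AllPairs R Z
  Sparse-AllPairs []                 _        = []
  Sparse-AllPairs (skip s)           (_ ∷ rs) = Sparse-AllPairs s rs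
  Sparse-AllPairs (keep {P = P} _ s) (r ∷ rs) =
    Sparse-All s (All.++⁻ʳ P r) ∷ Sparse-AllPairs s (AllPairs-++⁻ʳ P rs)

  Sparse-uncons : ∀ {W y Ys} → Sparse G W (y ∷ Ys) →
    ∃[ U ] ∃[ P ] ∃[ W′ ] (W ≡ U ++ y ∷ P ++ W′ × G ≤ length P × Sparse G W′ Ys)
  Sparse-uncons (skip {w} s) with U , P , W′ , refl , G≤P , s′ ← Sparse-uncons s =
    w ∷ U , P , W′ , refl , G≤P , s′
  Sparse-uncons (keep {P = P} {W} G≤P s) = [] , P , W , refl , G≤P , s

-- A gap of t + s(t+1) leaves room for s further elements, each followed by a gap of t.
module _ (t : ℕ) where

  keepEvery : ∀ s (P Wr : List ℕ) {W} → s * suc t ≤ length P → Sparse t Wr W →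
              ∃[ I ] (length I ≡ s × Sparse t (P ++ Wr) (I ++ W))
  keepEvery zero    P       Wr _   sp = [] , refl , skip-++ P sp
  keepEvery (suc s) (p ∷ P) Wr (s≤s len) sp
    with P₁ , P₂ , refl , refl ← splitAt-≤ t P (≤-trans (m≤m+n t _) len)
    with I , refl , spI ← keepEvery s P₂ Wr (length-++-≤ʳ P₁ len) sp =
    p ∷ I , refl , keep-++ P₁ ≤-refl spI

  Sparse-factor : ∀ s {X Z} → Sparse (t + s * suc t) X Z → ∃[ W ] (Sparse t X W × Sparse s W Z)
  Sparse-factor s []       = [] , [] , []
  Sparse-factor s (skip sp) with W , X⊇W , W⊇Z ← Sparse-factor s sp = W , skip X⊇W , W⊇Z
  Sparse-factor s (keep {w} {P} {Wr} len sp)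
    with W , Wr⊇W , W⊇Z ← Sparse-factor s sp
    with P₀ , P′ , refl , refl ← splitAt-≤ t P (≤-trans (m≤m+n t _) len)
    with I , refl , spI ← keepEvery s P′ Wr (length-++-≤ʳ P₀ len) Wr⊇W =
    w ∷ I ++ W , keep-++ P₀ ≤-refl spI , keep ≤-refl W⊇Z

-- ω^e-largeness with e unshifted (ExpLarge (suc e) = PowLarge e), extended to e = 0 by reading
-- ω^0·n-large as having exactly n elements.
ExpLarge : ℕ → List ℕ → Set
ExpLarge zero    Z = length Z ≡ 1
ExpLarge (suc e) Z = PowLarge e Z

ExpMulLarge : ℕ → ℕ → List ℕ → Set
ExpMulLarge zero    n Z = length Z ≡ n
ExpMulLarge (suc e) n Z = MulLarge e n Z

ExpMulLarge-[] : ∀ e → ExpMulLarge e 0 []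
ExpMulLarge-[] zero    = refl
ExpMulLarge-[] (suc e) = none

ExpMulLarge-++ : ∀ e {n Z₁ Z₂} → ExpLarge e Z₁ → ExpMulLarge e n Z₂ → Z₁ <ˢ Z₂ →
                 ExpMulLarge e (suc n) (Z₁ ++ Z₂)
ExpMulLarge-++ zero    {Z₁ = Z₁} l₁ l₂ _     = trans (length-++ Z₁) (cong₂ _+_ l₁ l₂)
ExpMulLarge-++ (suc e)           p₁ m₂ Z₁<Z₂ = more p₁ Z₁<Z₂ m₂

ExpMulLarge⇒PowLarge-∷ : ∀ e {w Z} → ExpMulLarge e w Z → All (w <_) Z → 1 ≤ w → PowLarge e (w ∷ Z)
ExpMulLarge⇒PowLarge-∷ zero                len _         _   = base (s≤s (≤-reflexive (sym len)))
ExpMulLarge⇒PowLarge-∷ (suc e) {Z = []}    m   _         1≤w = ⊥-elim (<⇒≱ 1≤w (MulLarge-length m))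
ExpMulLarge⇒PowLarge-∷ (suc e) {Z = _ ∷ _} m   (w<z ∷ _) _   = step w<z m

double : ℕ → ℕ
double zero    = zero
double (suc e) = suc (suc (double e))

-- Each level of largeness kept costs two: one level supplies the gaps, the other the pieces.
module SparseExtraction (G : ℕ) where
  mutual
    Sparse-PowLarge-∷ : ∀ e w P B R → G ≤ length P → PowLarge (suc (double e)) B → Ascending B →
      All (G ≤_) B → w < minL B → 1 ≤ w →
      ∃[ Z ] (PowLarge e (w ∷ Z) × Sparse G (w ∷ P ++ B ++ R) (w ∷ Z))
    Sparse-PowLarge-∷ e w P (b ∷ V) R G≤P (step _ m) (b< ∷ asc) (G≤b ∷ _) w<b 1≤w
      with V₁ , V₂ , V≡ , m₁ ← MulLarge-take m w (<⇒≤ w<b) =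
      let asc₁ = AllPairs-++⁻ˡ V₁ (subst Ascending V≡ asc)
          b<₁  = All.++⁻ˡ V₁ (subst (All (b <_)) V≡ b<)
          Z , mulZ , spZ , b<Z = Sparse-stack e w b V₁ m₁ asc₁ b<₁ G≤b (≤-trans (s≤s 1≤w) w<b)
      in Z , ExpMulLarge⇒PowLarge-∷ e mulZ (All.map (<-trans w<b) b<Z) 1≤w ,
         keep {P = P} G≤P (skip (subst (λ L → Sparse G (L ++ R) Z) (sym V≡)
                                  (Sparse-++ʳ R (Sparse-++ʳ V₂ spZ))))

    Sparse-stack : ∀ e n b V → MulLarge (double e) n V → Ascending V → All (b <_) V → G ≤ b → 2 ≤ b →
      ∃[ Z ] (ExpMulLarge e n Z × Sparse G V Z × All (b <_) Z)
    Sparse-stack e zero b [] none _ _ _ _ = [] , ExpMulLarge-[] e , [] , []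
    Sparse-stack e (suc n) b _ (more {X = C} {Y} p C<Y m) asc b< G≤b 2≤b
      with Z₁ , large₁ , sp₁ , b<₁ ← Sparse-block e b C p (AllPairs-++⁻ˡ C asc) (All.++⁻ˡ C b<) G≤b 2≤b
         | Z₂ , large₂ , sp₂ , b<₂ ← Sparse-stack e n b Y m (AllPairs-++⁻ʳ C asc) (All.++⁻ʳ C b<) G≤b 2≤b =
      Z₁ ++ Z₂ , ExpMulLarge-++ e large₁ large₂ (Sparse-All sp₁ (All.map (Sparse-All sp₂) C<Y)) ,
      Sparse-++ sp₁ sp₂ , All.++⁺ b<₁ b<₂

    Sparse-block : ∀ e b C → PowLarge (double e) C → Ascending C → All (b <_) C → G ≤ b → 2 ≤ b →
      ∃[ Z ] (ExpLarge e Z × Sparse G C Z × All (b <_) Z)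
    Sparse-block zero b (c ∷ C) (base c<) _ (b<c ∷ _) G≤b _ =
      c ∷ [] , refl ,
      subst (λ L → Sparse G (c ∷ L) (c ∷ [])) (++-identityʳ C)
        (keep {P = C} (≤-trans G≤b (≤-trans (<⇒≤ b<c) (≤-pred c<))) []) ,
      b<c ∷ []
    Sparse-block (suc e) b (c ∷ V) (step _ m) (c< ∷ asc) (b<c ∷ _) G≤b 2≤b
      with D₁ , D₂ , D₃ , R , V≡ , p₁ , _ , p₃ ← MulLarge-firstThree m (≤-trans (s≤s 2≤b) b<c) =
      let ascV = subst Ascending V≡ asc
          c<V  = subst (All (c <_)) V≡ c<
          c<D₃ = All.++⁻ˡ D₃ (All.++⁻ʳ D₂ (All.++⁻ʳ D₁ c<V))
          G≤c  = ≤-trans G≤b (<⇒≤ b<c)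
          G≤D₁ = ≤-trans G≤c (<⇒≤ (<-trans (All-minL (All.++⁻ˡ D₁ c<V) p₁) (PowLarge⇒minL<length p₁)))
          G≤D₁₂ = ≤-trans G≤D₁ (subst (length D₁ ≤_) (sym (length-++ D₁)) (m≤m+n _ _))
          Z , large , sp = Sparse-PowLarge-∷ e c (D₁ ++ D₂) D₃ R G≤D₁₂ p₃
                             (AllPairs-++⁻ˡ D₃ (AllPairs-++⁻ʳ D₂ (AllPairs-++⁻ʳ D₁ ascV)))
                             (All.map (≤-trans G≤c ∘ <⇒≤) c<D₃) (All-minL c<D₃ p₃)
                             (≤-trans (s≤s z≤n) (≤-trans 2≤b (<⇒≤ b<c)))
          sp′ = subst (λ L → Sparse G (c ∷ L) (c ∷ Z)) (trans (++-assoc D₁ D₂ (D₃ ++ R)) (sym V≡)) sp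
      in c ∷ Z , large , sp′ , Sparse-All sp′ (b<c ∷ All.map (<-trans b<c) c<)

-- (2^n − 1)(a + 1) ≤ |V|, with the subtraction moved to the right-hand side.
MulLarge₀-length : ∀ {n V} a → MulLarge 0 n V → Ascending V → All (a <_) V →
                   2 ^ n * (a + 1) ≤ length V + (a + 1)
MulLarge₀-length a none _ _ = ≤-reflexive (+-identityʳ (a + 1))
MulLarge₀-length {suc n} a (more {X = C} {Y} p _ m) asc a< = begin
  2 ^ suc n * (a + 1)             ≡⟨ doubling (2 ^ n) (a + 1) ⟩
  2 ^ n * ((a + 1) + (a + 1))     ≤⟨ *-monoʳ-≤ (2 ^ n) (+-monoʳ-≤ (a + 1) a+1≤C) ⟩
  2 ^ n * ((a + 1) + length C)    ≡⟨ cong (2 ^ n *_) (shift a (length C)) ⟩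
  2 ^ n * (a + length C + 1)      ≤⟨ MulLarge₀-length (a + length C) m (AllPairs-++⁻ʳ C asc) a+C<Y ⟩
  length Y + (a + length C + 1)   ≡⟨ regroup (length Y) a (length C) ⟩
  length C + length Y + (a + 1)   ≡⟨ cong (_+ (a + 1)) (sym (length-++ C)) ⟩
  length (C ++ Y) + (a + 1)       ∎
  where
  open ≤-Reasoning
  doubling : ∀ p x → 2 * p * x ≡ p * (x + x)
  doubling = solve-∀
  shift : ∀ a c → a + 1 + c ≡ a + c + 1
  shift = solve-∀
  regroup : ∀ y a c → y + (a + c + 1) ≡ c + y + (a + 1)
  regroup = solve-∀
  a+1≤C : a + 1 ≤ length C
  a+1≤C = subst (_≤ length C) (+-comm 1 a)
            (≤-trans (All-minL (All.++⁻ˡ C a<) p) (<⇒≤ (PowLarge⇒minL<length p)))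
  a+C<Y : All (a + length C <_) Y
  a+C<Y = All-≥-++ C (suc a) asc a<

2^minL≤length : ∀ e {B} → PowLarge (suc e) B → Ascending B → 2 ^ minL B ≤ length B
2^minL≤length e p asc with PowLarge-anti {suc e} {1} (s≤s z≤n) p | asc
... | step {x = b} {y} {ys} _ m | b< ∷ asc′ = +-cancelˡ-≤ b _ _ (begin
  b + 2 ^ b                     ≤⟨ +-monoˡ-≤ (2 ^ b) (m≤n*m b (2 ^ b) {{m^n≢0 2 b}}) ⟩
  2 ^ b * b + 2 ^ b             ≡⟨ cong (2 ^ b * b +_) (sym (*-identityʳ (2 ^ b))) ⟩
  2 ^ b * b + 2 ^ b * 1         ≡⟨ *-distribˡ-+ (2 ^ b) b 1 ⟨
  2 ^ b * (b + 1)               ≤⟨ MulLarge₀-length b m asc′ b< ⟩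
  length (y ∷ ys) + (b + 1)     ≡⟨ regroup (length ys) b ⟩
  b + length (b ∷ y ∷ ys)       ∎)
  where
  open ≤-Reasoning
  regroup : ∀ l b → suc l + (b + 1) ≡ b + suc (suc l)
  regroup = solve-∀

Sparse-PowLarge : ∀ d G (X : List ℕ) → PowLarge (suc (suc (double d))) X → Ascending X → 3 ≤ minL X →
  G ≤ 2 ^ 2 ^ suc (minL X) → ∃[ Z ] (PowLarge d Z × Sparse G X Z)
Sparse-PowLarge d G (m ∷ V) (step _ ms) (m< ∷ asc) 3≤m G≤
  with B₁ , B₂ , B₃ , R , V≡ , p₁ , p₂ , p₃ ← MulLarge-firstThree ms 3≤m =
  let Z , large , sp = SparseExtraction.Sparse-PowLarge-∷ G d m (B₁ ++ B₂) B₃ R gap p₃ asc₃ G≤B₃ m<B₃ 1≤m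
  in m ∷ Z , large ,
     subst (λ L → Sparse G (m ∷ L) (m ∷ Z)) (trans (++-assoc B₁ B₂ (B₃ ++ R)) (sym V≡)) sp
  where
  open ≤-Reasoning
  ascV = subst Ascending V≡ asc
  m<V  = subst (All (m <_)) V≡ m<
  asc₁ = AllPairs-++⁻ˡ B₁ ascV
  asc₂ = AllPairs-++⁻ˡ B₂ (AllPairs-++⁻ʳ B₁ ascV)
  asc₃ = AllPairs-++⁻ˡ B₃ (AllPairs-++⁻ʳ B₂ (AllPairs-++⁻ʳ B₁ ascV))
  1≤m  = ≤-trans (s≤s z≤n) 3≤m
  m<B₃ = All-minL (All.++⁻ˡ B₃ (All.++⁻ʳ B₂ (All.++⁻ʳ B₁ m<V))) p₃
  B₁≤B₂ : length B₁ ≤ minL B₂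
  B₁≤B₂ = All-minL (All.++⁻ˡ B₂ (All-≥-++ B₁ 0 ascV (All.tabulate (λ _ → z≤n)))) p₂
  gap : G ≤ length (B₁ ++ B₂)
  gap = begin
    G                   ≤⟨ G≤ ⟩
    2 ^ 2 ^ suc m       ≤⟨ ^-monoʳ-≤ 2 (^-monoʳ-≤ 2 (All-minL (All.++⁻ˡ B₁ m<V) p₁)) ⟩
    2 ^ 2 ^ minL B₁     ≤⟨ ^-monoʳ-≤ 2 (2^minL≤length (double d) p₁ asc₁) ⟩
    2 ^ length B₁       ≤⟨ ^-monoʳ-≤ 2 B₁≤B₂ ⟩
    2 ^ minL B₂         ≤⟨ 2^minL≤length (double d) p₂ asc₂ ⟩
    length B₂           ≤⟨ m≤n+m (length B₂) (length B₁) ⟩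
    length B₁ + length B₂ ≡⟨ length-++ B₁ ⟨
    length (B₁ ++ B₂)   ∎
  G≤B₃ : All (G ≤_) B₃
  G≤B₃ = All.map (≤-trans gap)
           (All.++⁻ˡ B₃ (All-≥-++ (B₁ ++ B₂) 0 (subst Ascending (sym (++-assoc B₁ B₂ (B₃ ++ R))) ascV)
                                   (All.tabulate (λ _ → z≤n))))

-- Strings and trees

⪯-refl : ∀ {σ} → σ ⪯ σ
⪯-refl {σ} = [] , ++-identityʳ σ

⪯-trans : ∀ {σ τ υ} → σ ⪯ τ → τ ⪯ υ → σ ⪯ υ
⪯-trans {σ} (ρ₁ , refl) (ρ₂ , refl) = ρ₁ ++ ρ₂ , sym (++-assoc σ ρ₁ ρ₂)

⪯-compare : ∀ σ τ {υ} → σ ⪯ υ → τ ⪯ υ → length σ ≤ length τ → σ ⪯ τ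
⪯-compare []      τ       _        _        _         = τ , refl
⪯-compare (a ∷ σ) (b ∷ τ) (ρ , e₁) (ρ′ , e₂) (s≤s σ≤τ)
  with δ , e ← ⪯-compare σ τ {τ ++ ρ′} (ρ , ∷-injectiveʳ (trans e₁ (sym e₂))) (ρ′ , refl) σ≤τ =
  δ , cong₂ _∷_ (∷-injectiveˡ (trans e₁ (sym e₂))) e

⪯-length : ∀ {σ τ} → σ ⪯ τ → length σ ≤ length τ
⪯-length {σ} (ρ , refl) = subst (length σ ≤_) (sym (length-++ σ)) (m≤m+n _ _)

⪯-unique : ∀ {σ τ υ} → σ ⪯ υ → τ ⪯ υ → length σ ≡ length τ → σ ≡ τ
⪯-unique {σ} {τ} (ρ , e₁) (ρ′ , e₂) = go σ τ (trans e₁ (sym e₂))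
  where
  go : ∀ σ τ → σ ++ ρ ≡ τ ++ ρ′ → length σ ≡ length τ → σ ≡ τ
  go []      []      _ _ = refl
  go (a ∷ σ) (b ∷ τ) e l = cong₂ _∷_ (∷-injectiveˡ e) (go σ τ (∷-injectiveʳ e) (suc-injective l))

⪯⇒≡ : ∀ {σ τ} → σ ⪯ τ → length σ ≡ length τ → σ ≡ τ
⪯⇒≡ σ⪯τ = ⪯-unique σ⪯τ ⪯-refl

≢⇒Incompatible : ∀ {τ₁ τ₂} → τ₁ ≢ τ₂ → length τ₁ ≡ length τ₂ → Incompatible τ₁ τ₂
≢⇒Incompatible τ₁≢τ₂ l = (λ p → τ₁≢τ₂ (⪯⇒≡ p l)) , (λ p → τ₁≢τ₂ (sym (⪯⇒≡ p (sym l))))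

Incompatible⇒≢ : ∀ {τ₁ τ₂} → Incompatible τ₁ τ₂ → τ₁ ≢ τ₂
Incompatible⇒≢ (τ₁⋠τ₂ , _) refl = τ₁⋠τ₂ ⪯-refl

∈-inits⁻ : ∀ {τ} σ → τ ∈ inits σ → τ ⪯ σ
∈-inits⁻ σ       (here refl) = σ , refl
∈-inits⁻ (b ∷ σ) (there m) with τ , τ∈ , refl ← ∈-map⁻ (b ∷_) {xs = inits σ} m
  with ρ , refl ← ∈-inits⁻ σ τ∈ = ρ , refl

∈-inits⁺ : ∀ {τ σ} → τ ⪯ σ → τ ∈ inits σ
∈-inits⁺ {[]}    _        = here refl
∈-inits⁺ {a ∷ τ} (ρ , refl) = there (∈-map⁺ (a ∷_) {xs = inits (τ ++ ρ)} (∈-inits⁺ (ρ , refl)))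

downClosure : List Str → List Str
downClosure = concatMap inits

∈-downClosure⁻ : ∀ {τ} L → τ ∈ downClosure L → ∃[ ℓ ] (ℓ ∈ L × τ ⪯ ℓ)
∈-downClosure⁻ L m with _ , τ∈ , ∈map ← ∈-concat⁻′ (map inits L) m
  with ℓ , ℓ∈L , refl ← ∈-map⁻ inits ∈map = ℓ , ℓ∈L , ∈-inits⁻ ℓ τ∈

∈-downClosure⁺ : ∀ {τ ℓ L} → ℓ ∈ L → τ ⪯ ℓ → τ ∈ downClosure L
∈-downClosure⁺ ℓ∈L τ⪯ℓ = ∈-concat⁺′ (∈-inits⁺ τ⪯ℓ) (∈-map⁺ inits ℓ∈L)

downClosure-isTree : ∀ L → IsTree (downClosure L)
downClosure-isTree L m τ⪯σ with ℓ , ℓ∈L , σ⪯ℓ ← ∈-downClosure⁻ L m = ∈-downClosure⁺ ℓ∈L (⪯-trans τ⪯σ σ⪯ℓ)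

downClosure-++⁺ˡ : ∀ {τ} L₁ L₂ → τ ∈ downClosure L₁ → τ ∈ downClosure (L₁ ++ L₂)
downClosure-++⁺ˡ L₁ L₂ m with ℓ , ℓ∈ , τ⪯ℓ ← ∈-downClosure⁻ L₁ m = ∈-downClosure⁺ (∈-++⁺ˡ ℓ∈) τ⪯ℓ

downClosure-++⁺ʳ : ∀ {τ} L₁ L₂ → τ ∈ downClosure L₂ → τ ∈ downClosure (L₁ ++ L₂)
downClosure-++⁺ʳ L₁ L₂ m with ℓ , ℓ∈ , τ⪯ℓ ← ∈-downClosure⁻ L₂ m = ∈-downClosure⁺ (∈-++⁺ʳ L₁ ℓ∈) τ⪯ℓ

downClosure-++⁻ : ∀ {τ} L₁ L₂ → τ ∈ downClosure (L₁ ++ L₂) → τ ∈ downClosure L₁ ⊎ τ ∈ downClosure L₂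
downClosure-++⁻ L₁ L₂ m with ℓ , ℓ∈ , τ⪯ℓ ← ∈-downClosure⁻ (L₁ ++ L₂) m with ∈-++⁻ L₁ ℓ∈
... | inj₁ ℓ∈L₁ = inj₁ (∈-downClosure⁺ ℓ∈L₁ τ⪯ℓ)
... | inj₂ ℓ∈L₂ = inj₂ (∈-downClosure⁺ ℓ∈L₂ τ⪯ℓ)

-- Colouring quasistrong trees

Consec-++⁺ : ∀ P {Xs a b} → Consec a b Xs → Consec a b (P ++ Xs)
Consec-++⁺ []      c = c
Consec-++⁺ (p ∷ P) c = there (Consec-++⁺ P c)

Consec⇒∈ : ∀ {x y L} → Consec x y L → x ∈ L
Consec⇒∈ here      = here refl
Consec⇒∈ (there c) = there (Consec⇒∈ c)

head≤ : ∀ {a L z} → Ascending (a ∷ L) → z ∈ a ∷ L → a ≤ z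
head≤ _        (here refl) = ≤-refl
head≤ (a< ∷ _) (there z∈) = <⇒≤ (All.lookup a< z∈)

lastOf : ℕ → List ℕ → ℕ
lastOf x []       = x
lastOf x (y ∷ ys) = lastOf y ys

lastOf-∈ : ∀ x xs → lastOf x xs ∈ x ∷ xs
lastOf-∈ x []       = here refl
lastOf-∈ x (y ∷ ys) = there (lastOf-∈ y ys)

lastOf-++ : ∀ p P {x Xs} → lastOf p (P ++ x ∷ Xs) ≡ lastOf x Xs
lastOf-++ p []      = refl
lastOf-++ p (q ∷ P) = lastOf-++ q P

maxL≡lastOf : ∀ {x Xs} → Ascending (x ∷ Xs) → maxL (x ∷ Xs) ≡ lastOf x Xs
maxL≡lastOf {x} {[]}     _          = ⊔-identityʳ x
maxL≡lastOf {x} {y ∷ Ys} (x< ∷ asc) =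
  trans (cong (x ⊔_) (maxL≡lastOf asc)) (m≤n⇒m⊔n≡n (<⇒≤ (All.lookup x< (lastOf-∈ y Ys))))

maxL-++-∷ : ∀ P {x Xs} → Ascending (P ++ x ∷ Xs) → maxL (P ++ x ∷ Xs) ≡ lastOf x Xs
maxL-++-∷ []      asc = maxL≡lastOf asc
maxL-++-∷ (p ∷ P) asc = trans (maxL≡lastOf asc) (lastOf-++ p P)

AllPairs-lookup : ∀ {A : Set} {R : A → A → Set} {xs : List A} → AllPairs R xs →
                  ∀ {i j} → i Fin.< j → R (lookup xs i) (lookup xs j)
AllPairs-lookup (r ∷ _)  {Fin.zero}  {Fin.suc j} _         = All.lookup r (∈-lookup j)
AllPairs-lookup (_ ∷ rs) {Fin.suc i} {Fin.suc j} (s≤s i<j) = AllPairs-lookup rs i<j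

pigeonhole-All : ∀ {k} {A : Set} {Q : A → Fin k → Set} (Ns : List A) → AllPairs _≢_ Ns →
  All (λ a → ∃ (Q a)) Ns → k < length Ns → ∃[ a ] ∃[ b ] ∃[ c ] (a ≢ b × Q a c × Q b c)
pigeonhole-All {Q = Q} Ns distinct coloured k<Ns =
  let i , j , i<j , same = pigeonhole k<Ns (proj₁ ∘ colourAt) in
  lookup Ns i , lookup Ns j , proj₁ (colourAt i) , AllPairs-lookup distinct i<j ,
  proj₂ (colourAt i) , subst (Q (lookup Ns j)) (sym same) (proj₂ (colourAt j))
  where
  colourAt : ∀ i → ∃ (Q (lookup Ns i))
  colourAt i = All.lookup coloured (∈-lookup i)

Splits : List Str → Str → ℕ → Set
Splits S ρ y = ∃[ τ₁ ] ∃[ τ₂ ]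
  ( Incompatible τ₁ τ₂
  × (τ₁ ∈ S × length τ₁ ≡ y × ρ ⪯ τ₁)
  × (τ₂ ∈ S × length τ₂ ≡ y × ρ ⪯ τ₂)
  × (∀ {τ} → τ ∈ S → length τ ≡ y → ρ ⪯ τ → τ ≡ τ₁ ⊎ τ ≡ τ₂))

Splits-transfer : ∀ {S S′ ρ y} → Splits S ρ y → S ⊆ S′ → (∀ {τ} → τ ∈ S′ → ρ ⪯ τ → τ ∈ S) →
                  Splits S′ ρ y
Splits-transfer (τ₁ , τ₂ , τ₁⊥τ₂ , (τ₁∈ , l₁ , ρ⪯τ₁) , (τ₂∈ , l₂ , ρ⪯τ₂) , onlyTwo) S⊆S′ back =
  τ₁ , τ₂ , τ₁⊥τ₂ , (S⊆S′ τ₁∈ , l₁ , ρ⪯τ₁) , (S⊆S′ τ₂∈ , l₂ , ρ⪯τ₂) ,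
  λ τ∈ lτ ρ⪯τ → onlyTwo (back τ∈ ρ⪯τ) lτ ρ⪯τ

ExtendsToColour : ∀ {k} → List Str → List ℕ → (Str → Fin k) → Fin k → Str → Set
ExtendsToColour T X C c σ = ∃[ τ ] (τ ∈ T × length τ ≡ maxL X × σ ⪯ τ × C τ ≡ c)

TreeRamsey : ℕ → List ℕ → List ℕ → Set
TreeRamsey k X Y =
  ∀ (T : List Str) → Quasistrong X T → (C : Str → Fin k) →
    ∃[ c ] ∃[ S ] (Quasistrong Y S × S ⊆ T × (∀ {σ} → IsLeaf S σ → ExtendsToColour T X C c σ))

module TreeColouring {k} (X : List ℕ) (ascX : Ascending X) (T : List Str) (qsT : Quasistrong X T)
                     (C : Str → Fin k) where

  Tail : List ℕ → Set
  Tail Xs = ∃[ P ] (P ++ Xs ≡ X)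

  Tail-++⁻ : ∀ U {Xs} → Tail (U ++ Xs) → Tail Xs
  Tail-++⁻ U {Xs} (P , e) = P ++ U , trans (++-assoc P U Xs) e

  Tail-maxL : ∀ {x Xs} → Tail (x ∷ Xs) → maxL X ≡ lastOf x Xs
  Tail-maxL (P , e) = trans (cong maxL (sym e)) (maxL-++-∷ P (subst Ascending (sym e) ascX))

  branch : ∀ {x y Xs} → Tail (x ∷ y ∷ Xs) → ∀ {σ} → σ ∈ T → length σ ≡ x → Splits T σ y
  branch (P , e) = proj₂ (proj₂ qsT) (subst (Consec _ _) e (Consec-++⁺ P here))

  NodeAbove : Str → ℕ → Str → Set
  NodeAbove σ y τ = τ ∈ T × length τ ≡ y × σ ⪯ τ

  NodeAbove-⪯ : ∀ {ρ σ y τ} → ρ ⪯ σ → NodeAbove σ y τ → NodeAbove ρ y τ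
  NodeAbove-⪯ ρ⪯σ (τ∈T , lτ , σ⪯τ) = τ∈T , lτ , ⪯-trans ρ⪯σ σ⪯τ

  extendToTop : ∀ {x} Xs {σ} → Tail (x ∷ Xs) → σ ∈ T → length σ ≡ x → ∃[ τ ] NodeAbove σ (lastOf x Xs) τ
  extendToTop []        _  σ∈T lσ = _ , σ∈T , lσ , ⪯-refl
  extendToTop (x′ ∷ Xs) tl σ∈T lσ
    with τ₁ , _ , _ , (τ₁∈T , lτ₁ , σ⪯τ₁) , _ ← branch tl σ∈T lσ
    with τ , above ← extendToTop Xs (Tail-++⁻ (_ ∷ []) tl) τ₁∈T lτ₁ = τ , NodeAbove-⪯ σ⪯τ₁ above

  manyAbove : ∀ {x} Q {y R σ} → Tail (x ∷ Q ++ y ∷ R) → σ ∈ T → length σ ≡ x →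
    ∃[ Ns ] (All (NodeAbove σ y) Ns × AllPairs _≢_ Ns × 2 ^ suc (length Q) ≤ length Ns)
  manyAbove [] tl σ∈T lσ with τ₁ , τ₂ , τ₁⊥τ₂ , above₁ , above₂ , _ ← branch tl σ∈T lσ =
    τ₁ ∷ τ₂ ∷ [] , above₁ ∷ above₂ ∷ [] , (Incompatible⇒≢ τ₁⊥τ₂ ∷ []) ∷ [] ∷ [] , ≤-refl
  manyAbove (q ∷ Q) {y} tl σ∈T lσ
    with τ₁ , τ₂ , τ₁⊥τ₂ , (τ₁∈T , lτ₁ , σ⪯τ₁) , (τ₂∈T , lτ₂ , σ⪯τ₂) , _ ← branch tl σ∈T lσ
    with N₁ , above₁ , distinct₁ , many₁ ← manyAbove Q (Tail-++⁻ (_ ∷ []) tl) τ₁∈T lτ₁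
       | N₂ , above₂ , distinct₂ , many₂ ← manyAbove Q (Tail-++⁻ (_ ∷ []) tl) τ₂∈T lτ₂ =
    N₁ ++ N₂ ,
    All.++⁺ (All.map (NodeAbove-⪯ σ⪯τ₁) above₁) (All.map (NodeAbove-⪯ σ⪯τ₂) above₂) ,
    AllPairs.++⁺ distinct₁ distinct₂ (All.map (λ a₁ → All.map (apart a₁) above₂) above₁) ,
    subst (_ ≤_) (sym (length-++ N₁)) (+-mono-≤ many₁ (subst (_≤ length N₂) (sym (+-identityʳ _)) many₂))
    where
    apart : ∀ {a b} → NodeAbove τ₁ y a → NodeAbove τ₂ y b → a ≢ b
    apart (_ , la , τ₁⪯a) (_ , lb , τ₂⪯b) refl =
      Incompatible⇒≢ τ₁⊥τ₂ (⪯-unique τ₁⪯a τ₂⪯b (trans lτ₁ (sym lτ₂)))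

  data StrongTree (c : Fin k) : List ℕ → Str → List Str → Set where
    leaf : ∀ {y σ} → σ ∈ T → length σ ≡ y → ExtendsToColour T X C c σ → StrongTree c (y ∷ []) σ (σ ∷ [])
    node : ∀ {y y′ Ys σ τ₁ τ₂ L₁ L₂} → σ ∈ T → length σ ≡ y → τ₁ ≢ τ₂ → σ ⪯ τ₁ → σ ⪯ τ₂ →
           StrongTree c (y′ ∷ Ys) τ₁ L₁ → StrongTree c (y′ ∷ Ys) τ₂ L₂ →
           StrongTree c (y ∷ y′ ∷ Ys) σ (L₁ ++ L₂)

  module _ {c : Fin k} where

    root-level : ∀ {y Ys σ L} → StrongTree c (y ∷ Ys) σ L → length σ ≡ y
    root-level (leaf _ lσ _)         = lσ
    root-level (node _ lσ _ _ _ _ _) = lσ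

    root-⪯-leaf : ∀ {Ys σ L} → StrongTree c Ys σ L → ∀ {ℓ} → ℓ ∈ L → σ ⪯ ℓ
    root-⪯-leaf (leaf _ _ _) (here refl) = ⪯-refl
    root-⪯-leaf (node {L₁ = L₁} _ _ _ σ⪯τ₁ σ⪯τ₂ t₁ t₂) ℓ∈ with ∈-++⁻ L₁ ℓ∈
    ... | inj₁ ℓ∈₁ = ⪯-trans σ⪯τ₁ (root-⪯-leaf t₁ ℓ∈₁)
    ... | inj₂ ℓ∈₂ = ⪯-trans σ⪯τ₂ (root-⪯-leaf t₂ ℓ∈₂)

    leaf-∈T : ∀ {Ys σ L} → StrongTree c Ys σ L → ∀ {ℓ} → ℓ ∈ L → ℓ ∈ T
    leaf-∈T (leaf σ∈T _ _) (here refl) = σ∈T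
    leaf-∈T (node {L₁ = L₁} _ _ _ _ _ t₁ t₂) ℓ∈ with ∈-++⁻ L₁ ℓ∈
    ... | inj₁ ℓ∈₁ = leaf-∈T t₁ ℓ∈₁
    ... | inj₂ ℓ∈₂ = leaf-∈T t₂ ℓ∈₂

    leaf-colour : ∀ {Ys σ L} → StrongTree c Ys σ L → ∀ {ℓ} → ℓ ∈ L → ExtendsToColour T X C c ℓ
    leaf-colour (leaf _ _ ext) (here refl) = ext
    leaf-colour (node {L₁ = L₁} _ _ _ _ _ t₁ t₂) ℓ∈ with ∈-++⁻ L₁ ℓ∈
    ... | inj₁ ℓ∈₁ = leaf-colour t₁ ℓ∈₁
    ... | inj₂ ℓ∈₂ = leaf-colour t₂ ℓ∈₂

    root-∈ : ∀ {Ys σ L} → StrongTree c Ys σ L → σ ∈ downClosure L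
    root-∈ (leaf {σ = σ} _ _ _) = ∈-downClosure⁺ {L = σ ∷ []} (here refl) ⪯-refl
    root-∈ (node {L₁ = L₁} {L₂} _ _ _ σ⪯τ₁ _ t₁ _) =
      downClosure-++⁺ˡ L₁ L₂ (downClosure-isTree L₁ (root-∈ t₁) σ⪯τ₁)

    root-⪯ : ∀ {Ys σ L τ} → StrongTree c Ys σ L → τ ∈ downClosure L → length σ ≤ length τ → σ ⪯ τ
    root-⪯ {L = L} {τ} t τ∈ σ≤τ with ℓ , ℓ∈L , τ⪯ℓ ← ∈-downClosure⁻ L τ∈ =
      ⪯-compare _ τ (root-⪯-leaf t ℓ∈L) τ⪯ℓ σ≤τ

    root-≡ : ∀ {Ys σ L τ} → StrongTree c Ys σ L → τ ∈ downClosure L → length τ ≡ length σ → τ ≡ σ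
    root-≡ t τ∈ l = sym (⪯⇒≡ (root-⪯ t τ∈ (≤-reflexive (sym l))) (sym l))

    levels : ∀ {Ys σ L} → StrongTree c Ys σ L → ∀ {x} → x ∈ Ys → ∃[ ρ ] (ρ ∈ downClosure L × length ρ ≡ x)
    levels t (here refl) = _ , root-∈ t , root-level t
    levels (node {L₁ = L₁} {L₂} _ _ _ _ _ t₁ _) (there x∈)
      with ρ , ρ∈ , lρ ← levels t₁ x∈ = ρ , downClosure-++⁺ˡ L₁ L₂ ρ∈ , lρ

    splitsAtRoot : ∀ {y y′ Ys σ L} → StrongTree c (y ∷ y′ ∷ Ys) σ L → Splits (downClosure L) σ y′
    splitsAtRoot (node {τ₁ = τ₁} {τ₂} {L₁} {L₂} _ _ τ₁≢τ₂ σ⪯τ₁ σ⪯τ₂ t₁ t₂) =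
      τ₁ , τ₂ , ≢⇒Incompatible τ₁≢τ₂ (trans (root-level t₁) (sym (root-level t₂))) ,
      (downClosure-++⁺ˡ L₁ L₂ (root-∈ t₁) , root-level t₁ , σ⪯τ₁) ,
      (downClosure-++⁺ʳ L₁ L₂ (root-∈ t₂) , root-level t₂ , σ⪯τ₂) , onlyTwo
      where
      onlyTwo : ∀ {τ} → τ ∈ downClosure (L₁ ++ L₂) → length τ ≡ _ → _ ⪯ τ → τ ≡ τ₁ ⊎ τ ≡ τ₂
      onlyTwo τ∈ lτ _ with downClosure-++⁻ L₁ L₂ τ∈
      ... | inj₁ τ∈₁ = inj₁ (root-≡ t₁ τ∈₁ (trans lτ (sym (root-level t₁))))
      ... | inj₂ τ∈₂ = inj₂ (root-≡ t₂ τ∈₂ (trans lτ (sym (root-level t₂))))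

    -- Above the roots, the down-closures of two subtrees with distinct roots on one level are disjoint.
    stayInside : ∀ {Ys₁ Ys₂ τ₁ τ₂ L₁ L₂} → StrongTree c Ys₁ τ₁ L₁ → StrongTree c Ys₂ τ₂ L₂ →
      τ₁ ≢ τ₂ → length τ₁ ≡ length τ₂ → ∀ {ρ τ} → ρ ∈ downClosure L₁ → length τ₁ ≤ length ρ →
      τ ∈ downClosure L₁ ⊎ τ ∈ downClosure L₂ → ρ ⪯ τ → τ ∈ downClosure L₁
    stayInside _  _  _     _ _  _    (inj₁ τ∈₁) _   = τ∈₁
    stayInside t₁ t₂ τ₁≢τ₂ l ρ∈ deep (inj₂ τ∈₂) ρ⪯τ =
      ⊥-elim (τ₁≢τ₂ (⪯-unique (⪯-trans (root-⪯ t₁ ρ∈ deep) ρ⪯τ)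
                             (root-⪯ t₂ τ∈₂ (≤-trans (≤-reflexive (sym l)) (≤-trans deep (⪯-length ρ⪯τ))))
                             l))

    root-below : ∀ {y Ys τ L} → StrongTree c (y ∷ Ys) τ L → Ascending (y ∷ Ys) →
                 ∀ {x z} → Consec x z (y ∷ Ys) → length τ ≤ x
    root-below t asc x→z = subst (_≤ _) (sym (root-level t)) (head≤ asc (Consec⇒∈ x→z))

    splits : ∀ {Ys σ L} → StrongTree c Ys σ L → Ascending Ys → ∀ {x y} → Consec x y Ys →
             ∀ {ρ} → ρ ∈ downClosure L → length ρ ≡ x → Splits (downClosure L) ρ y
    splits t _ here ρ∈ lρ with refl ← root-≡ t ρ∈ (trans lρ (sym (root-level t))) = splitsAtRoot t
    splits (node {L₁ = L₁} {L₂} _ _ τ₁≢τ₂ _ _ t₁ t₂) (_ ∷ asc) (there x→y) ρ∈ lρ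
      with downClosure-++⁻ L₁ L₂ ρ∈
    ... | inj₁ ρ∈₁ =
      Splits-transfer (splits t₁ asc x→y ρ∈₁ lρ) (downClosure-++⁺ˡ L₁ L₂)
        (λ τ∈ → stayInside t₁ t₂ τ₁≢τ₂ (trans (root-level t₁) (sym (root-level t₂))) ρ∈₁
                  (subst (_ ≤_) (sym lρ) (root-below t₁ asc x→y)) (downClosure-++⁻ L₁ L₂ τ∈))
    ... | inj₂ ρ∈₂ =
      Splits-transfer (splits t₂ asc x→y ρ∈₂ lρ) (downClosure-++⁺ʳ L₁ L₂)
        (λ τ∈ → stayInside t₂ t₁ (τ₁≢τ₂ ∘ sym) (trans (root-level t₂) (sym (root-level t₁))) ρ∈₂
                  (subst (_ ≤_) (sym lρ) (root-below t₂ asc x→y)) (swap (downClosure-++⁻ L₁ L₂ τ∈)))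

  -- Sparseness gives at least 2^(k+1) > k candidate nodes on the next level; two of them get
  -- the same colour, and their strong subtrees combine.
  build : ∀ y P W Ys {σ} → Tail (y ∷ P ++ W) → k ≤ length P → Sparse k W Ys → σ ∈ T → length σ ≡ y →
          ∃[ c ] ∃[ L ] StrongTree c (y ∷ Ys) σ L
  build y P W [] tl _ _ σ∈T lσ with τ , τ∈T , lτ , σ⪯τ ← extendToTop (P ++ W) tl σ∈T lσ =
    C τ , _ , leaf σ∈T lσ (τ , τ∈T , trans lτ (sym (Tail-maxL tl)) , σ⪯τ , refl)
  build y P W (y′ ∷ Ys) {σ} tl k≤P sp σ∈T lσ with U , P′ , W′ , refl , k≤P′ , sp′ ← Sparse-uncons sp =
    let Ns , above , distinct , many = manyAbove (P ++ U) tl′ σ∈T lσ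
        τ₁ , τ₂ , c , τ₁≢τ₂ , (σ⪯τ₁ , L₁ , t₁) , (σ⪯τ₂ , L₂ , t₂) =
          pigeonhole-All {Q = Subtree} Ns distinct (All.map subtree above) (≤-trans k<2^suc[P++U] many)
    in c , L₁ ++ L₂ , node σ∈T lσ τ₁≢τ₂ σ⪯τ₁ σ⪯τ₂ t₁ t₂
    where
    tl′ : Tail (y ∷ (P ++ U) ++ y′ ∷ P′ ++ W′)
    tl′ = subst (λ L → Tail (y ∷ L)) (sym (++-assoc P U (y′ ∷ P′ ++ W′))) tl
    Subtree : Str → Fin k → Set
    Subtree τ c = σ ⪯ τ × ∃[ L ] StrongTree c (y′ ∷ Ys) τ L
    subtree : ∀ {τ} → NodeAbove σ y′ τ → ∃ (Subtree τ)
    subtree (τ∈T , lτ , σ⪯τ) with c , L , t ← build y′ P′ W′ Ys (Tail-++⁻ (y ∷ P ++ U) tl′) k≤P′ sp′ τ∈T lτ =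
      c , σ⪯τ , L , t
    k<2^suc[P++U] : k < 2 ^ suc (length (P ++ U))
    k<2^suc[P++U] = <-≤-trans (n<2^n k) (^-monoʳ-≤ 2 (≤-trans k≤P
      (≤-trans (subst (length P ≤_) (sym (length-++ P)) (m≤m+n _ _)) (n≤1+n _))))

  colourSubtree : ∀ {Y} → Sparse k X Y → Fin k →
    ∃[ c ] ∃[ S ] (Quasistrong Y S × S ⊆ T × (∀ {σ} → IsLeaf S σ → ExtendsToColour T X C c σ))
  colourSubtree {[]} _ c = c , [] , ((λ ()) , (λ ()) , (λ ())) , (λ ()) , λ { (() , _) }
  colourSubtree {y ∷ Ys} sp _
    with U , P , W , X≡ , k≤P , sp′ ← Sparse-uncons sp
    with σ , σ∈T , lσ ← proj₁ (proj₂ qsT) (subst (y ∈_) (sym X≡) (∈-++⁺ʳ U (here refl)))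
    with c , L , t ← build y P W Ys (U , sym X≡) k≤P sp′ σ∈T lσ =
    c , downClosure L ,
    (downClosure-isTree L , levels t , splits t (Sparse-AllPairs sp ascX)) ,
    (λ τ∈ → let ℓ , ℓ∈L , τ⪯ℓ = ∈-downClosure⁻ L τ∈ in proj₁ qsT (leaf-∈T t ℓ∈L) τ⪯ℓ) ,
    λ { (σ∈ , maximal) → let ℓ , ℓ∈L , σ⪯ℓ = ∈-downClosure⁻ L σ∈ in
                         subst (ExtendsToColour T X C c) (maximal (∈-downClosure⁺ ℓ∈L ⪯-refl) σ⪯ℓ)
                               (leaf-colour t ℓ∈L) }

Sparse⇒TreeRamsey : ∀ {k X Y} → 0 < k → Ascending X → Sparse k X Y → TreeRamsey k X Y
Sparse⇒TreeRamsey {X = X} 0<k ascX sp T qsT C =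
  TreeColouring.colourSubtree X ascX T qsT C sp (fromℕ< 0<k)

-- Persistence

gap : ℕ → ℕ → ℕ
gap t zero    = t
gap t (suc j) = t + gap t j * suc t

Sparse⇒Persistent : ∀ d n k j {X Z} → 0 < k → Ascending X → Sparse (gap k j) X Z → ω^ d · n -large Z →
                    Persistent d n k (suc j) X
Sparse⇒Persistent d n k zero {Z = Z} 0<k ascX sp large =
  Z , AllPairs⇒Linked (Sparse-AllPairs sp ascX) , Sparse-⊆ sp , large , Sparse⇒TreeRamsey 0<k ascX sp
Sparse⇒Persistent d n k (suc j) 0<k ascX sp large with W , X⊇W , W⊇Z ← Sparse-factor k (gap k j) sp =
  W , AllPairs⇒Linked ascW , Sparse-⊆ X⊇W , Sparse⇒Persistent d n k j 0<k ascW W⊇Z large ,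
  Sparse⇒TreeRamsey 0<k ascX X⊇W
  where
  ascW = Sparse-AllPairs X⊇W ascX

suc-gap : ∀ t j → suc (gap t j) ≡ suc t ^ suc j
suc-gap t zero    = sym (*-identityʳ (suc t))
suc-gap t (suc j) = trans (factor t (gap t j)) (cong (suc t *_) (suc-gap t j))
  where
  factor : ∀ t g → suc (t + g * suc t) ≡ suc t * suc g
  factor = solve-∀

m*m≤2^suc[m] : ∀ m → m * m ≤ 2 ^ suc m
m*m≤2^suc[m] zero    = z≤n
m*m≤2^suc[m] (suc m) = begin
  suc m * suc m               ≡⟨ expand m ⟩
  m * m + (m + suc m)         ≤⟨ +-mono-≤ (m*m≤2^suc[m] m) (+-mono-≤ (<⇒≤ (n<2^n m)) (n<2^n m)) ⟩
  2 ^ suc m + (2 ^ m + 2 ^ m) ≡⟨ collect (2 ^ m) ⟩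
  2 ^ suc (suc m)             ∎
  where
  open ≤-Reasoning
  expand : ∀ m → suc m * suc m ≡ m * m + (m + suc m)
  expand = solve-∀
  collect : ∀ p → 2 * p + (p + p) ≡ 2 * (2 * p)
  collect = solve-∀

gap≤2^2^suc : ∀ k j m → k < m → suc j < m → gap k j ≤ 2 ^ 2 ^ suc m
gap≤2^2^suc k j m@(suc _) k<m j<m = begin
  gap k j            ≤⟨ n≤1+n _ ⟩
  suc (gap k j)      ≡⟨ suc-gap k j ⟩
  suc k ^ suc j      ≤⟨ ^-monoˡ-≤ (suc j) k<m ⟩
  m ^ suc j          ≤⟨ ^-monoʳ-≤ m (<⇒≤ j<m) ⟩
  m ^ m              ≤⟨ ^-monoˡ-≤ m (<⇒≤ (n<2^n m)) ⟩
  (2 ^ m) ^ m        ≡⟨ ^-*-assoc 2 m m ⟩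
  2 ^ (m * m)        ≤⟨ ^-monoʳ-≤ 2 (m*m≤2^suc[m] m) ⟩
  2 ^ 2 ^ suc m      ∎
  where open ≤-Reasoning

n≤double : ∀ n → n ≤ double n
n≤double zero    = z≤n
n≤double (suc n) = s≤s (≤-trans (n≤double n) (n≤1+n _))

double≡2* : ∀ n → double n ≡ 2 * n
double≡2* zero    = refl
double≡2* (suc n) = trans (cong (suc ∘ suc) (double≡2* n)) (sym (*-distribˡ-+ 2 1 n))

corollary2p12 : (d k i : ℕ) → 0 < d → 1 ≤ k → (X : List ℕ) → Increasing X →
    ω^ (2 * d + 1) -large X → (k ⊔ i) ⊔ 2 < minL X → Persistent d 1 k i X
corollary2p12 (suc d) k i _ 0<k X incX large bound = persistent i (m⊔n<o⇒n<o k i k⊔i<m)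
  where
  X-large : PowLarge (double (suc d)) X
  X-large = subst (λ e → PowLarge e X) (trans (m+n∸n≡m (2 * suc d) 1) (sym (double≡2* (suc d)))) large
  ascX : Ascending X
  ascX = Linked⇒AllPairs <-trans incX
  k⊔i<m : k ⊔ i < minL X
  k⊔i<m = m⊔n<o⇒m<o (k ⊔ i) 2 bound
  persistent : ∀ i → i < minL X → Persistent (suc d) 1 k i X
  persistent zero    _   = PowLarge⇒MulLarge₁ (PowLarge-anti (≤-trans (n≤double d) (m≤n+m _ 2)) X-large)
  persistent (suc j) j<m =
    let k<m = m⊔n<o⇒m<o k i k⊔i<m
        Z , Z-large , sp = Sparse-PowLarge d (gap k j) X X-large ascX (m⊔n<o⇒n<o (k ⊔ i) 2 bound)
                             (gap≤2^2^suc k j (minL X) k<m j<m)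
    in Sparse⇒Persistent (suc d) 1 k j 0<k ascX sp (PowLarge⇒MulLarge₁ Z-large)
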